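{- Exhaustive blocked clause elimination is symmetry-preserving: for all CNF formulas $F$ and $F^*$ such that $F^*$ is obtained from $F$ by removing blocked clauses until no clause is blocked, we have $\mathrm{Aut}_{\mathrm{syn}}(F)_{\{\mathrm{Lit}(F^*)\}}=\mathrm{Aut}_{\mathrm{syn}}(F)$ and $\mathrm{Aut}_{\mathrm{syn}}(F)\downarrow_{\mathrm{Lit}(F^*)}\subseteq\mathrm{Aut}_{\mathrm{syn}}(F^*)$.
   Context: Literals: each variable $v$ gives literals $v,\bar v$ with $\bar{\bar v}=v$. A CNF formula $F$ is a finite set of clauses, each a finite set of literals; $\mathrm{Var}(F)$ is the set of variables occurring in $F$, $\mathrm{Lit}(F):=\mathrm{Var}(F)\cup\{\bar v:v\in\mathrm{Var}(F)\}$. Bijections of literals act elementwise on clauses and formulas. A syntactic symmetry of $F$ is a bijection $\varphi:\mathrm{Lit}(F)\to\mathrm{Lit}(F)$ with $\varphi(F)=F$ and $\overline{\varphi(l)}=\varphi(\bar l)$ for all $l$; these form the group $\mathrm{Aut}_{\mathrm{syn}}(F)$. For a permutation group $\Gamma$ on $\Omega$ and $\Omega'\subseteq\Omega$: $\Gamma_{\{\Omega'\}}:=\{\varphi\in\Gamma:\varphi(\Omega')=\Omega'\}$ and $\Gamma\downarrow_{\Omega'}:=\{\varphi|_{\Omega'}:\varphi\in\Gamma_{\{\Omega'\}}\}$. For clauses $C_1\ni x$, $C_2\ni\bar x$, the resolvent is $C_1\circ_x C_2:=(C_1\setminus\{x\})\cup(C_2\setminus\{\bar x\})$. A literal $l\in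 C$ blocks the clause $C\in F$ if for every $C'\in F$ with $\bar l\in C'$, the resolvent $C\circ_l C'$ is a tautology (contains some literal together with its negation). $C$ is blocked if some literal blocks it. Blocked clause elimination transforms $F$ into $F\setminus\{C\}$ for a blocked clause $C\in F$. -}

module Defs where

open import Data.Nat using (ℕ)
open import Data.List using (List; map)
open import Data.List.Membership.Propositional using (_∈_)
open import Data.Product using (Σ; ∃; _×_)
open import Data.Sum using (_⊎_)
open import Relation.Nullary using (¬_)
open import Relation.Binary.PropositionalEquality using (_≡_; _≢_)
open import Relation.Binary.Construct.Closure.ReflexiveTransitive using (Star)

data Lit : Set where
  pos : ℕ → Lit
  neg : ℕ → Lit

var : Lit → ℕ
var (pos v) = v
var (neg v) = v

compl : Lit → Lit
compl (pos v) = neg v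
compl (neg v) = pos v

-- A clause is a finite set of literals, represented by a list read as a set.
Clause : Set
Clause = List Lit

_≈C_ : Clause → Clause → Set
C ≈C D = ∀ l → (l ∈ C → l ∈ D) × (l ∈ D → l ∈ C)

-- A CNF formula is a finite set of clauses, represented by a list read as a set.
Formula : Set
Formula = List Clause

_∈F_ : Clause → Formula → Set
C ∈F F = ∃ λ D → D ∈ F × C ≈C D

VarIn : Formula → ℕ → Set
VarIn F v = ∃ λ C → C ∈ F × (pos v ∈ C ⊎ neg v ∈ C)

LitIn : Formula → Lit → Set
LitIn F l = VarIn F (var l)

mapC : (Lit → Lit) → Clause → Clause
mapC φ C = map φ C

-- φ is a syntactic symmetry of F: φ restricted to Lit(F) is a bijection
-- Lit(F) → Lit(F) commuting with complement and with φ(F) = F.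
-- (Only the values of φ on Lit(F) matter.)
record IsSynSym (F : Formula) (φ : Lit → Lit) : Set where
  field
    maps-into  : ∀ l → LitIn F l → LitIn F (φ l)
    injective  : ∀ l l' → LitIn F l → LitIn F l' → φ l ≡ φ l' → l ≡ l'
    surjective : ∀ l → LitIn F l → ∃ λ l' → LitIn F l' × φ l' ≡ l
    compl-comm : ∀ l → LitIn F l → φ (compl l) ≡ compl (φ l)
    image-sub  : ∀ C → C ∈ F → mapC φ C ∈F F
    image-sup  : ∀ D → D ∈ F → ∃ λ C → C ∈ F × mapC φ C ≈C D

Stabilizes : (Lit → Set) → (Lit → Lit) → Set
Stabilizes S φ = (∀ l → S l → S (φ l)) × (∀ l → S l → ∃ λ l' → S l' × φ l' ≡ l)

InResolvent : Lit → Clause → Clause → Lit → Set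
InResolvent x C₁ C₂ m = (m ∈ C₁ × m ≢ x) ⊎ (m ∈ C₂ × m ≢ compl x)

TautResolvent : Lit → Clause → Clause → Set
TautResolvent x C₁ C₂ = ∃ λ m → InResolvent x C₁ C₂ m × InResolvent x C₁ C₂ (compl m)

Blocks : Formula → Lit → Clause → Set
Blocks F l C = l ∈ C × (∀ C' → C' ∈ F → compl l ∈ C' → TautResolvent l C C')

Blocked : Formula → Clause → Set
Blocked F C = ∃ λ l → Blocks F l C

-- one step of blocked clause elimination: F' = F ∖ {C} for a blocked C ∈ F
BCEStep : Formula → Formula → Set
BCEStep F F' = ∃ λ C → C ∈ F × Blocked F C ×
  (∀ D → (D ∈F F' → D ∈F F × ¬ (D ≈C C)) × (D ∈F F × ¬ (D ≈C C) → D ∈F F'))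

ExhaustiveBCE : Formula → Formula → Set
ExhaustiveBCE F F* = Star BCEStep F F* × (∀ C → C ∈ F* → ¬ Blocked F* C)

-- A complement-respecting injective renaming of literals preserves tautological
-- resolvents in both directions, hence transports blocking literals.  Follow the BCE run
-- from F to F*: each removed clause C is blocked in the current formula G.  If C ≈ φ D
-- with D ∈ F*, then (as φ F* ⊆ G inductively) the preimage of the blocking literal blocks
-- D in F*; if C ≈ E with φ E ∈ F*, then (as every clause of F* is φ of a clause still
-- in G) the image of the blocking literal blocks φ E in F*.  Both contradict
-- exhaustiveness, so φ F* ⊆ F* ⊆ φ F*, and the rest is bookkeeping.
module Submission where

open import Defs
open import Data.Product using (_×_; _,_; proj₁; proj₂; ∃)
open import Data.Sum using (_⊎_; inj₁; inj₂)
open import Data.Empty using (⊥)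
open import Function using (id; flip; _∘_)
open import Relation.Nullary using (¬_)
open import Relation.Binary.PropositionalEquality
  using (_≡_; _≢_; refl; sym; trans; cong; subst; module ≡-Reasoning)
open import Relation.Binary.Construct.Closure.ReflexiveTransitive using (Star; fold)
open import Data.List.Membership.Propositional using (_∈_)
open import Data.List.Membership.Propositional.Properties using (∈-map⁺; ∈-map⁻)

compl-involutive : ∀ l → compl (compl l) ≡ l
compl-involutive (pos v) = refl
compl-involutive (neg v) = refl

≈C-refl : ∀ {C} → C ≈C C
≈C-refl l = id , id

≈C-sym : ∀ {C D} → C ≈C D → D ≈C C
≈C-sym e l = proj₂ (e l) , proj₁ (e l)

≈C-trans : ∀ {C D E} → C ≈C D → D ≈C E → C ≈C E
≈C-trans e f l = (λ x → proj₁ (f l) (proj₁ (e l) x)) , (λ x → proj₂ (e l) (proj₂ (f l) x))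

mapC-cong : ∀ ψ {C D} → C ≈C D → mapC ψ C ≈C mapC ψ D
mapC-cong ψ e l = forth e , forth (≈C-sym e)
  where
  forth : ∀ {C D} → C ≈C D → l ∈ mapC ψ C → l ∈ mapC ψ D
  forth e l∈ with ∈-map⁻ ψ l∈
  ... | k , k∈ , refl = ∈-map⁺ ψ (proj₁ (e k) k∈)

_⊆F_ : Formula → Formula → Set
G ⊆F H = ∀ C → C ∈ G → C ∈F H

∈F-resp-≈C : ∀ {C D G} → C ≈C D → D ∈F G → C ∈F G
∈F-resp-≈C e (E , E∈ , e') = E , E∈ , ≈C-trans e e'

∈F-mono : ∀ {C G H} → G ⊆F H → C ∈F G → C ∈F H
∈F-mono G⊆H (D , D∈ , e) = ∈F-resp-≈C e (G⊆H D D∈)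

⊆F-refl : ∀ {G} → G ⊆F G
⊆F-refl D D∈ = D , D∈ , ≈C-refl

⊆F-trans : ∀ {G H K} → G ⊆F H → H ⊆F K → G ⊆F K
⊆F-trans G⊆H H⊆K D D∈ = ∈F-mono H⊆K (G⊆H D D∈)

Occurs : Lit → Clause → Set
Occurs l C = l ∈ C ⊎ compl l ∈ C

litIn-intro : ∀ {F C} l → C ∈ F → Occurs l C → LitIn F l
litIn-intro {C = C} (pos v) C∈ occ = C , C∈ , occ
litIn-intro {C = C} (neg v) C∈ (inj₁ l∈) = C , C∈ , inj₂ l∈
litIn-intro {C = C} (neg v) C∈ (inj₂ l̄∈) = C , C∈ , inj₁ l̄∈

litIn-elim : ∀ {F} l → LitIn F l → ∃ λ C → C ∈ F × Occurs l C
litIn-elim (pos v) occ = occ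
litIn-elim (neg v) (C , C∈ , inj₁ l̄∈) = C , C∈ , inj₂ l̄∈
litIn-elim (neg v) (C , C∈ , inj₂ l∈) = C , C∈ , inj₁ l∈

litIn-compl : ∀ {F} l → LitIn F l → LitIn F (compl l)
litIn-compl (pos v) occ = occ
litIn-compl (neg v) occ = occ

occurs-resp-≈C : ∀ {C D} l → C ≈C D → Occurs l C → Occurs l D
occurs-resp-≈C l e (inj₁ l∈) = inj₁ (proj₁ (e _) l∈)
occurs-resp-≈C l e (inj₂ l̄∈) = inj₂ (proj₁ (e _) l̄∈)

litIn-∈F : ∀ {F C} l → C ∈F F → Occurs l C → LitIn F l
litIn-∈F l (D , D∈ , e) occ = litIn-intro l D∈ (occurs-resp-≈C l e occ)

litIn-mono : ∀ {G H} → G ⊆F H → ∀ l → LitIn G l → LitIn H l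
litIn-mono G⊆H l occ with litIn-elim l occ
... | C , C∈ , occ' = litIn-∈F l (G⊆H C C∈) occ'

inResolvent-resp-≈C : ∀ {x C₁ C₂ D₁ D₂ m} → C₁ ≈C D₁ → C₂ ≈C D₂ →
  InResolvent x C₁ C₂ m → InResolvent x D₁ D₂ m
inResolvent-resp-≈C e₁ e₂ (inj₁ (m∈ , m≢)) = inj₁ (proj₁ (e₁ _) m∈ , m≢)
inResolvent-resp-≈C e₁ e₂ (inj₂ (m∈ , m≢)) = inj₂ (proj₁ (e₂ _) m∈ , m≢)

tautResolvent-resp-≈C : ∀ {x C₁ C₂ D₁ D₂} → C₁ ≈C D₁ → C₂ ≈C D₂ →
  TautResolvent x C₁ C₂ → TautResolvent x D₁ D₂
tautResolvent-resp-≈C e₁ e₂ (m , r , r̄) =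
  m , inResolvent-resp-≈C e₁ e₂ r , inResolvent-resp-≈C e₁ e₂ r̄

blocks-resp-≈C : ∀ {G l C D} → C ≈C D → Blocks G l C → Blocks G l D
blocks-resp-≈C e (l∈ , taut) =
  proj₁ (e _) l∈ , λ C' C'∈ l̄∈ → tautResolvent-resp-≈C e ≈C-refl (taut C' C'∈ l̄∈)

blocks-tautResolvent-∈F : ∀ {G l C C'} → Blocks G l C → C' ∈F G → compl l ∈ C' →
  TautResolvent l C C'
blocks-tautResolvent-∈F (_ , taut) (D , D∈ , e) l̄∈ =
  tautResolvent-resp-≈C ≈C-refl (≈C-sym e) (taut D D∈ (proj₁ (e _) l̄∈))

record IsRenamingOn (S : Lit → Set) (ψ : Lit → Lit) : Set where
  field
    compl-closed : ∀ {l} → S l → S (compl l)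
    injective    : ∀ {l l'} → S l → S l' → ψ l ≡ ψ l' → l ≡ l'
    compl-comm   : ∀ {l} → S l → ψ (compl l) ≡ compl (ψ l)

LitsIn : (Lit → Set) → Clause → Set
LitsIn S C = ∀ {m} → m ∈ C → S m

module Renaming {S : Lit → Set} {ψ : Lit → Lit} (ρ : IsRenamingOn S ψ) where
  open IsRenamingOn ρ

  ≢-map : ∀ {m l} → S m → S l → m ≢ l → ψ m ≢ ψ l
  ≢-map Sm Sl m≢l eq = m≢l (injective Sm Sl eq)

  occurs-pushforward : ∀ {l C} → S l → Occurs l C → Occurs (ψ l) (mapC ψ C)
  occurs-pushforward Sl (inj₁ l∈) = inj₁ (∈-map⁺ ψ l∈)
  occurs-pushforward Sl (inj₂ l̄∈) = inj₂ (subst (_∈ _) (compl-comm Sl) (∈-map⁺ ψ l̄∈))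

  occurs-pullback : ∀ {l C} → LitsIn S C → Occurs l (mapC ψ C) →
    ∃ λ k → Occurs k C × ψ k ≡ l
  occurs-pullback SC (inj₁ l∈) with ∈-map⁻ ψ l∈
  ... | k , k∈ , refl = k , inj₁ k∈ , refl
  occurs-pullback {l} SC (inj₂ l̄∈) with ∈-map⁻ ψ l̄∈
  ... | k , k∈ , ψk≡ = compl k , inj₂ (subst (_∈ _) (sym (compl-involutive k)) k∈) , (begin
    ψ (compl k)        ≡⟨ compl-comm (SC k∈) ⟩
    compl (ψ k)        ≡⟨ cong compl (sym ψk≡) ⟩
    compl (compl l)    ≡⟨ compl-involutive l ⟩
    l                  ∎)
    where open ≡-Reasoning

  inResolvent-pushforward : ∀ {l E E' m} → S l → LitsIn S E → LitsIn S E' →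
    InResolvent l E E' m → S m × InResolvent (ψ l) (mapC ψ E) (mapC ψ E') (ψ m)
  inResolvent-pushforward Sl SE SE' (inj₁ (m∈ , m≢)) =
    SE m∈ , inj₁ (∈-map⁺ ψ m∈ , ≢-map (SE m∈) Sl m≢)
  inResolvent-pushforward Sl SE SE' (inj₂ (m∈ , m≢)) =
    SE' m∈ , inj₂ (∈-map⁺ ψ m∈ ,
      λ eq → ≢-map (SE' m∈) (compl-closed Sl) m≢ (trans eq (sym (compl-comm Sl))))

  tautResolvent-pushforward : ∀ {l E E'} → S l → LitsIn S E → LitsIn S E' →
    TautResolvent l E E' → TautResolvent (ψ l) (mapC ψ E) (mapC ψ E')
  tautResolvent-pushforward Sl SE SE' (m , r , r̄)
    with inResolvent-pushforward Sl SE SE' r | inResolvent-pushforward Sl SE SE' r̄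
  ... | Sm , ψr | _ , ψr̄ = ψ m , ψr , subst (InResolvent _ _ _) (compl-comm Sm) ψr̄

  inResolvent-pullback : ∀ {l D D' m} → S l → LitsIn S D → LitsIn S D' →
    InResolvent (ψ l) (mapC ψ D) (mapC ψ D') m →
    ∃ λ k → S k × ψ k ≡ m × InResolvent l D D' k
  inResolvent-pullback Sl SD SD' (inj₁ (m∈ , m≢)) with ∈-map⁻ ψ m∈
  ... | k , k∈ , refl = k , SD k∈ , refl , inj₁ (k∈ , λ k≡l → m≢ (cong ψ k≡l))
  inResolvent-pullback Sl SD SD' (inj₂ (m∈ , m≢)) with ∈-map⁻ ψ m∈
  ... | k , k∈ , refl =
    k , SD' k∈ , refl , inj₂ (k∈ , λ k≡l̄ → m≢ (trans (cong ψ k≡l̄) (compl-comm Sl)))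

  tautResolvent-pullback : ∀ {l D D'} → S l → LitsIn S D → LitsIn S D' →
    TautResolvent (ψ l) (mapC ψ D) (mapC ψ D') → TautResolvent l D D'
  tautResolvent-pullback Sl SD SD' (m , r , r̄)
    with inResolvent-pullback Sl SD SD' r | inResolvent-pullback Sl SD SD' r̄
  ... | k , Sk , refl , kr | k̄ , Sk̄ , ψk̄≡ , k̄r =
    k , kr , subst (InResolvent _ _ _) k̄≡compl-k k̄r
    where
    k̄≡compl-k : k̄ ≡ compl k
    k̄≡compl-k = injective Sk̄ (compl-closed Sk) (trans ψk̄≡ (sym (compl-comm Sk)))

  blocks-pushforward : ∀ {G H l E} → LitsIn S E →
    (∀ C' → C' ∈ H → compl (ψ l) ∈ C' →
      ∃ λ E' → E' ∈F G × LitsIn S E' × mapC ψ E' ≈C C') →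
    Blocks G l E → Blocks H (ψ l) (mapC ψ E)
  blocks-pushforward {l = l} {E} SE preimage bl@(l∈ , _) = ∈-map⁺ ψ l∈ , taut
    where
    Sl : S l
    Sl = SE l∈
    taut : ∀ C' → C' ∈ _ → compl (ψ l) ∈ C' → TautResolvent (ψ l) (mapC ψ E) C'
    taut C' C'∈ ψl̄∈ with preimage C' C'∈ ψl̄∈
    ... | E' , E'∈ , SE' , e with ∈-map⁻ ψ (proj₂ (e _) ψl̄∈)
    ... | k , k∈ , ψk≡ =
      tautResolvent-resp-≈C ≈C-refl e
        (tautResolvent-pushforward Sl SE SE' (blocks-tautResolvent-∈F bl E'∈ l̄∈))
      where
      l̄∈ : compl l ∈ E'
      l̄∈ = subst (_∈ E')
        (injective (SE' k∈) (compl-closed Sl) (trans (sym ψk≡) (sym (compl-comm Sl)))) k∈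

  blocks-pullback : ∀ {G H l D} → LitsIn S D →
    (∀ C' → C' ∈ H → compl l ∈ C' → LitsIn S C' × mapC ψ C' ∈F G) →
    l ∈ D → Blocks G (ψ l) (mapC ψ D) → Blocks H l D
  blocks-pullback {l = l} SD image l∈ bl = l∈ , taut
    where
    taut : ∀ C' → C' ∈ _ → compl l ∈ C' → TautResolvent l _ C'
    taut C' C'∈ l̄∈ with image C' C'∈ l̄∈
    ... | SC' , ψC'∈ = tautResolvent-pullback (SD l∈) SD SC'
      (blocks-tautResolvent-∈F bl ψC'∈
        (subst (_∈ mapC ψ C') (compl-comm (SD l∈)) (∈-map⁺ ψ l̄∈)))

bceStep-⊆F : ∀ {G G'} → BCEStep G G' → G' ⊆F G
bceStep-⊆F (_ , _ , _ , spec) D D∈ = proj₁ (proj₁ (spec D) (D , D∈ , ≈C-refl))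

bceStep-retains : ∀ {G G' D} → BCEStep G G' → D ∈F G →
  (∀ C → C ∈ G → Blocked G C → D ≈C C → ⊥) → D ∈F G'
bceStep-retains (C , C∈ , blocked , spec) D∈ not-removed =
  proj₂ (spec _) (D∈ , not-removed C C∈ blocked)

bce-⊆F : ∀ {G H} → Star BCEStep G H → H ⊆F G
bce-⊆F = fold (flip _⊆F_) (λ step H⊆G' → ⊆F-trans H⊆G' (bceStep-⊆F step)) ⊆F-refl

bce-preserves : (P : Formula → Set) → (∀ {G G'} → BCEStep G G' → P G → P G') →
  ∀ {G H} → Star BCEStep G H → P G → P H
bce-preserves P step-preserves =
  fold (λ G H → P G → P H) (λ step k → k ∘ step-preserves step) id

module ExhaustiveBCESymmetry {F F* : Formula} (bce : ExhaustiveBCE F F*)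
                             {φ : Lit → Lit} (σ : IsSynSym F φ) where
  open IsSynSym σ

  φ-renaming : IsRenamingOn (LitIn F) φ
  φ-renaming = record
    { compl-closed = λ {l} → litIn-compl l
    ; injective    = λ {l} {l'} → injective l l'
    ; compl-comm   = λ {l} → compl-comm l
    }
  open Renaming φ-renaming

  F*⊆F : F* ⊆F F
  F*⊆F = bce-⊆F (proj₁ bce)

  unblocked : ∀ {D} → D ∈ F* → ∀ {l} → ¬ Blocks F* l D
  unblocked D∈ bl = proj₂ bce _ D∈ (_ , bl)

  litsIn-F : ∀ {C} → C ∈F F → LitsIn (LitIn F) C
  litsIn-F C∈ m∈ = litIn-∈F _ C∈ (inj₁ m∈)

  litsIn-F* : ∀ {C} → C ∈ F* → LitsIn (LitIn F) C
  litsIn-F* C∈ = litsIn-F (F*⊆F _ C∈)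

  image-∈F : ∀ {C} → C ∈F F → mapC φ C ∈F F
  image-∈F (D , D∈ , e) = ∈F-resp-≈C (mapC-cong φ e) (image-sub D D∈)

  preimage-∈F : ∀ {C} → C ∈F F → ∃ λ E → E ∈ F × mapC φ E ≈C C
  preimage-∈F (D , D∈ , e) with image-sup D D∈
  ... | E , E∈ , e' = E , E∈ , ≈C-trans e' (≈C-sym e)

  ImageIn : Formula → Set
  ImageIn G = ∀ D → D ∈ F* → mapC φ D ∈F G

  imageIn-step : ∀ {G G'} → BCEStep G G' → ImageIn G → ImageIn G'
  imageIn-step {G} step φF*⊆G D D∈ = bceStep-retains step (φF*⊆G D D∈) removed-not-image
    where
    removed-not-image : ∀ C → C ∈ G → Blocked G C → mapC φ D ≈C C → ⊥
    removed-not-image C _ (l , bl) e with ∈-map⁻ φ (proj₂ (e l) (proj₁ bl))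
    ... | k , k∈ , refl = unblocked D∈ (blocks-pullback (litsIn-F* D∈)
      (λ C' C'∈ _ → litsIn-F* C'∈ , φF*⊆G C' C'∈) k∈ (blocks-resp-≈C (≈C-sym e) bl))

  image-closed : ImageIn F*
  image-closed =
    bce-preserves ImageIn imageIn-step (proj₁ bce) (λ D D∈ → image-∈F (F*⊆F D D∈))

  PreimageIn : Formula → Set
  PreimageIn G = ∀ E → E ∈ F → mapC φ E ∈F F* → E ∈F G

  preimageIn-step : ∀ {G G'} → BCEStep G G' → PreimageIn G → PreimageIn G'
  preimageIn-step {G} step φ⁻¹F*⊆G E E∈ φE∈@(D , D∈ , φE≈D) =
    bceStep-retains step (φ⁻¹F*⊆G E E∈ φE∈) removed-not-preimage
    where
    preimage-in-G : ∀ {l} C' → C' ∈ F* → compl l ∈ C' →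
      ∃ λ E' → E' ∈F G × LitsIn (LitIn F) E' × mapC φ E' ≈C C'
    preimage-in-G C' C'∈ _ with preimage-∈F (F*⊆F C' C'∈)
    ... | E' , E'∈ , e =
      E' , φ⁻¹F*⊆G E' E'∈ (C' , C'∈ , e) , litsIn-F (E' , E'∈ , ≈C-refl) , e
    removed-not-preimage : ∀ C → C ∈ G → Blocked G C → E ≈C C → ⊥
    removed-not-preimage C _ (l , bl) e = unblocked D∈ (blocks-resp-≈C φE≈D
      (blocks-pushforward (litsIn-F (E , E∈ , ≈C-refl)) preimage-in-G
        (blocks-resp-≈C (≈C-sym e) bl)))

  preimage-closed : ∀ D → D ∈ F* → ∃ λ E → E ∈ F* × mapC φ E ≈C D
  preimage-closed D D∈ with preimage-∈F (F*⊆F D D∈)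
  ... | E , E∈ , e with bce-preserves PreimageIn preimageIn-step (proj₁ bce)
                          (λ _ E₀∈ _ → _ , E₀∈ , ≈C-refl) E E∈ (D , D∈ , e)
  ... | E' , E'∈ , e' = E' , E'∈ , ≈C-trans (mapC-cong φ (≈C-sym e')) e

  litIn-F : ∀ l → LitIn F* l → LitIn F l
  litIn-F = litIn-mono F*⊆F

  isSynSym : IsSynSym F* φ
  isSynSym = record
    { maps-into  = maps-into*
    ; injective  = λ l l' occ occ' → injective l l' (litIn-F l occ) (litIn-F l' occ')
    ; surjective = surjective*
    ; compl-comm = λ l occ → compl-comm l (litIn-F l occ)
    ; image-sub  = image-closed
    ; image-sup  = preimage-closed
    }
    where
    maps-into* : ∀ l → LitIn F* l → LitIn F* (φ l)
    maps-into* l occ with litIn-elim l occ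
    ... | C , C∈ , l∈C =
      litIn-∈F (φ l) (image-closed C C∈) (occurs-pushforward (litIn-F l occ) l∈C)
    surjective* : ∀ l → LitIn F* l → ∃ λ k → LitIn F* k × φ k ≡ l
    surjective* l occ with litIn-elim l occ
    ... | C , C∈ , l∈C with preimage-closed C C∈
    ... | E , E∈ , e with occurs-pullback (litsIn-F* E∈) (occurs-resp-≈C l (≈C-sym e) l∈C)
    ... | k , k∈E , refl = k , litIn-intro k E∈ k∈E , refl

  stabilizes : Stabilizes (LitIn F*) φ
  stabilizes = IsSynSym.maps-into isSynSym , IsSynSym.surjective isSynSym

lemma8 : (F F* : Formula) → ExhaustiveBCE F F* →
    (∀ φ → IsSynSym F φ → Stabilizes (LitIn F*) φ)
    × (∀ φ → IsSynSym F φ → Stabilizes (LitIn F*) φ → IsSynSym F* φ)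
lemma8 F F* bce =
  (λ φ σ → ExhaustiveBCESymmetry.stabilizes bce σ) ,
  -- the stabiliser hypothesis is redundant, being the first half
  (λ φ σ _ → ExhaustiveBCESymmetry.isSynSym bce σ)
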